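{- For every $n\ge 5$ and every $k$ with $1\le k\le n-2$, there exists a (strongly connected) tournament $T_{n,k}$ on $n$ vertices such that $\overrightarrow{rvc}(T_{n,k})=\overrightarrow{srvc}(T_{n,k})=k$.
   Context: A tournament is a digraph in which every two distinct vertices are joined by exactly one arc (in one direction). A (directed) path is a sequence of distinct vertices $x_0,\dots,x_\ell$ with each $x_{i-1}x_i$ an arc; its length is $\ell$. A digraph is strongly connected if for every ordered pair $(u,v)$ there is a $u$–$v$ path; a $u$–$v$ geodesic is a shortest $u$–$v$ path. In a vertex-coloured digraph, a path is rainbow if its internal vertices have pairwise distinct colours. A vertex-colouring of a strongly connected digraph $D$ is rainbow vertex-connected if every ordered pair $(u,v)$ is joined by a rainbow $u$–$v$ path, and strongly rainbow vertex-connected if every ordered pair is joined by a rainbow $u$–$v$ geodesic. $\overrightarrow{rvc}(D)$ (resp. $\overrightarrow{srvc}(D)$) is the minimum number of colours in a rainbow vertex-connected (resp. strongly rainbow vertex-connected) vertex-colouring of $D$. -}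

module Defs where

open import Level using (0ℓ)
open import Data.Nat using (ℕ; _≤_; _<_)
open import Data.Fin using (Fin)
open import Data.List using (List; []; _∷_; _++_; map; length)
open import Data.List.Relation.Unary.Unique.Propositional using (Unique)
open import Data.List.Relation.Unary.Linked using (Linked)
open import Data.Product using (Σ; ∃; _×_)
open import Data.Sum using (_⊎_)
open import Relation.Binary using (Rel)
open import Relation.Binary.PropositionalEquality using (_≡_; _≢_)
open import Relation.Nullary using (¬_)

Digraph : ℕ → Set₁
Digraph n = Rel (Fin n) 0ℓ

IsTournament : ∀ {n} → Digraph n → Set
IsTournament {n} D =
  (∀ (x : Fin n) → ¬ D x x) ×
  (∀ (x y : Fin n) → x ≢ y → D x y ⊎ D y x) ×
  (∀ (x y : Fin n) → D x y → ¬ D y x)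

-- A u–v path with internal vertex list ws: the vertex sequence
-- u ∷ ws ++ [v] is duplicate-free and consecutive vertices are arcs.
-- Its length is length ws + 1 (we only use it for u ≢ v).
IsPath : ∀ {n} → Digraph n → Fin n → Fin n → List (Fin n) → Set
IsPath D u v ws = Unique (u ∷ ws ++ v ∷ []) × Linked D (u ∷ ws ++ v ∷ [])

IsGeodesic : ∀ {n} → Digraph n → Fin n → Fin n → List (Fin n) → Set
IsGeodesic D u v ws =
  IsPath D u v ws × (∀ ws′ → IsPath D u v ws′ → length ws ≤ length ws′)

StronglyConnected : ∀ {n} → Digraph n → Set
StronglyConnected {n} D = ∀ (u v : Fin n) → u ≢ v → ∃ λ ws → IsPath D u v ws

Rainbow : ∀ {n k} → (Fin n → Fin k) → List (Fin n) → Set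
Rainbow c ws = Unique (map c ws)

RainbowVertexConnected : ∀ {n k} → Digraph n → (Fin n → Fin k) → Set
RainbowVertexConnected {n} D c =
  ∀ (u v : Fin n) → u ≢ v → ∃ λ ws → IsPath D u v ws × Rainbow c ws

StronglyRainbowVertexConnected : ∀ {n k} → Digraph n → (Fin n → Fin k) → Set
StronglyRainbowVertexConnected {n} D c =
  ∀ (u v : Fin n) → u ≢ v → ∃ λ ws → IsGeodesic D u v ws × Rainbow c ws

RVCWith : ∀ {n} → Digraph n → ℕ → Set
RVCWith {n} D k = Σ (Fin n → Fin k) λ c → RainbowVertexConnected D c

SRVCWith : ∀ {n} → Digraph n → ℕ → Set
SRVCWith {n} D k = Σ (Fin n → Fin k) λ c → StronglyRainbowVertexConnected D c

rvc≡ : ∀ {n} → Digraph n → ℕ → Set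
rvc≡ D k = RVCWith D k × (∀ m → m < k → ¬ RVCWith D m)

srvc≡ : ∀ {n} → Digraph n → ℕ → Set
srvc≡ D k = SRVCWith D k × (∀ m → m < k → ¬ SRVCWith D m)

-- For k = 1, any tournament of diameter two works: a geodesic has at most one
-- internal vertex, so one colour suffices. Such tournaments exist on 5 and 6 vertices,
-- and adjoining two vertices a → b → (old vertices) → a preserves diameter two.
-- For k ≥ 2, place n − k − 1 vertices, transitively ordered, on level 0 and one
-- vertex on each of the levels 1, …, k + 1, with arcs one level up or at least two
-- levels down. A path gains at most one level per arc, so a path from level 0 to
-- level k + 1 has at least k internal vertices and rvc ≥ k; colouring level i with
-- i − 1 makes suitable geodesics rainbow, so srvc ≤ k.
module Submission where

open import Defs
open import Data.Bool using (Bool; T; _∧_; _∨_)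
open import Data.Empty using (⊥; ⊥-elim)
open import Data.Fin using (Fin; zero; suc; toℕ)
open import Data.Fin.Properties using (toℕ-injective; toℕ<n; toℕ-fromℕ<; injective⇒≤; all?; any?; _≟_)
open import Data.List using (List; []; _∷_; _++_; map; length; lookup)
open import Data.List.Membership.Propositional.Properties using (∈-lookup)
open import Data.List.Relation.Unary.All as All using ([]; _∷_)
import Data.List.Relation.Unary.AllPairs as AllPairs
open import Data.List.Relation.Unary.Linked as Linked using (Linked; []; [-]; _∷_)
open import Data.List.Relation.Unary.Linked.Properties using (Linked⇒AllPairs; map⁺)
open import Data.List.Relation.Unary.Unique.Propositional using (Unique; []; _∷_)
open import Data.List.Properties using (length-map)
open import Data.Nat using (ℕ; zero; suc; _+_; _∸_; _≤_; _<_; z≤n; s≤s; _≡ᵇ_; _<ᵇ_; _%_)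
  renaming (_≟_ to _≟ℕ_)
open import Data.Nat.DivMod using (_mod_; m<n⇒m%n≡m)
open import Data.Nat.Properties
  using ( ≤-refl; ≤-reflexive; ≤-trans; ≤-pred; <-irrefl; <-trans; <-asym; <-cmp; <⇒≱; <⇒≤
        ; 1+n≰n; n≤1+n; m≤n+m; m≤n⇒m<n∨m≡n; suc-injective; module ≤-Reasoning
        ; +-comm; +-suc; +-identityʳ; +-monoʳ-≤; +-monoˡ-<; +-cancelʳ-≤
        ; ∸-monoˡ-≤; m+n∸n≡m; m+[n∸m]≡n; m∸n+n≡m; m∸n≢0⇒n<m; m≤o∸n⇒m+n≤o )
open import Data.Product using (Σ; ∃; _×_; _,_; proj₁; map₁; map₂)
open import Data.Sum using (_⊎_; inj₁; inj₂)
open import Data.Unit using (⊤; tt)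
open import Function using (_on_; _∘_; const)
open import Function.Definitions using (Injective)
open import Relation.Binary.Definitions using (Decidable; tri<; tri≈; tri>)
open import Relation.Binary.PropositionalEquality
open import Relation.Nullary using (¬_; Dec; ¬?)
open import Relation.Nullary.Decidable using (toWitness; T?; decidable-stable; _×-dec_; _⊎-dec_; _→-dec_)

private
  variable
    A : Set
    n k : ℕ
    D : Digraph n

Unique⇒lookup-injective : {xs : List A} → Unique xs → Injective _≡_ _≡_ (lookup xs)
Unique⇒lookup-injective (_ ∷ _)          {zero}  {zero}  _  = refl
Unique⇒lookup-injective (x∉xs ∷ _)       {zero}  {suc j} eq = ⊥-elim (All.lookup x∉xs (∈-lookup j) eq)
Unique⇒lookup-injective (x∉xs ∷ _)       {suc i} {zero}  eq = ⊥-elim (All.lookup x∉xs (∈-lookup i) (sym eq))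
Unique⇒lookup-injective (_ ∷ unique-xs)  {suc i} {suc j} eq = cong suc (Unique⇒lookup-injective unique-xs eq)

Unique⇒length≤ : {xs : List (Fin n)} → Unique xs → length xs ≤ n
Unique⇒length≤ = injective⇒≤ ∘ Unique⇒lookup-injective

increasing⇒Unique : (f : A → ℕ) {xs : List A} → Linked (_<_ on f) xs → Unique xs
increasing⇒Unique f = AllPairs.map (λ f[x]<f[y] x≡y → <-irrefl (cong f x≡y) f[x]<f[y]) ∘ Linked⇒AllPairs <-trans

srvc⇒rvc : {c : Fin n → Fin k} → StronglyRainbowVertexConnected D c → RainbowVertexConnected D c
srvc⇒rvc srvc u v u≢v = map₂ (map₁ proj₁) (srvc u v u≢v)

pathLength⇒¬RVCWith : ∀ {u v k} → u ≢ v → (∀ ws → IsPath D u v ws → k ≤ length ws) →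
                      ∀ m → m < k → ¬ RVCWith D m
pathLength⇒¬RVCWith {u = u} {v} {k} u≢v long m m<k (c , rvc) with ws , path , rainbow ← rvc u v u≢v =
  <⇒≱ m<k (begin
    k                ≤⟨ long ws path ⟩
    length ws        ≡⟨ length-map c ws ⟨
    length (map c ws) ≤⟨ Unique⇒length≤ rainbow ⟩
    m                ∎)
  where open ≤-Reasoning

RvcSrvcTournament : Digraph n → ℕ → Set
RvcSrvcTournament T k = IsTournament T × StronglyConnected T × rvc≡ T k × srvc≡ T k

rvc≡srvc≡ : IsTournament D → (c : Fin n → Fin k) → StronglyRainbowVertexConnected D c →
            (∀ m → m < k → ¬ RVCWith D m) → RvcSrvcTournament D k
rvc≡srvc≡ tournament c srvc below =
  tournament ,
  (λ u v u≢v → map₂ proj₁ (srvc⇒rvc srvc u v u≢v)) ,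
  ((c , srvc⇒rvc srvc) , below) ,
  ((c , srvc) , λ m m<k (c′ , srvc′) → below m m<k (c′ , srvc⇒rvc srvc′))

arc⇒IsGeodesic : ∀ {u v} → u ≢ v → D u v → IsGeodesic D u v []
arc⇒IsGeodesic u≢v uv = ((u≢v ∷ []) ∷ [] ∷ [] , uv ∷ [-]) , λ _ _ → z≤n

detour⇒IsGeodesic : IsTournament D → ∀ {u w v} → u ≢ v → D u w → D w v → D v u → IsGeodesic D u v (w ∷ [])
detour⇒IsGeodesic {D = D} (loopless , _ , asym) {u} {w} {v} u≢v uw wv vu =
  ((distinct uw ∷ u≢v ∷ []) ∷ (distinct wv ∷ []) ∷ [] ∷ [] , uw ∷ wv ∷ [-]) , shortest
  where
  distinct : ∀ {x y} → D x y → x ≢ y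
  distinct xy refl = loopless _ xy
  shortest : ∀ ws → IsPath D u v ws → 1 ≤ length ws
  shortest []      (_ , uv ∷ _) = ⊥-elim (asym v u vu uv)
  shortest (_ ∷ _) _            = s≤s z≤n

height-bound : (h : Fin n → ℕ) → (∀ {a b} → D a b → h b ≤ suc (h a)) →
               ∀ {x} ws {v} → Linked D (x ∷ ws ++ v ∷ []) → h v ≤ suc (length ws + h x)
height-bound h step []       (xv ∷ _) = step xv
height-bound h step {x} (w ∷ ws) {v} (xw ∷ path) = begin
  h v                          ≤⟨ height-bound h step ws path ⟩
  suc (length ws + h w)        ≤⟨ s≤s (+-monoʳ-≤ (length ws) (step xw)) ⟩
  suc (length ws + suc (h x))  ≡⟨ cong suc (+-suc (length ws) (h x)) ⟩
  suc (length (w ∷ ws) + h x)  ∎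
  where open ≤-Reasoning

Diameter≤2 : Digraph n → Set
Diameter≤2 {n} D = ∀ (u v : Fin n) → u ≢ v → D u v ⊎ ∃ λ w → D u w × D w v

Diameter≤2⇒srvc : IsTournament D → Diameter≤2 D → (c : Fin n → Fin k) → StronglyRainbowVertexConnected D c
Diameter≤2⇒srvc tournament@(_ , total , _) diameter c u v u≢v with diameter u v u≢v | total u v u≢v
... | inj₁ uv              | _        = [] , arc⇒IsGeodesic u≢v uv , []
... | inj₂ _               | inj₁ uv  = [] , arc⇒IsGeodesic u≢v uv , []
... | inj₂ (w , uw , wv)   | inj₂ vu  = w ∷ [] , detour⇒IsGeodesic tournament u≢v uw wv vu , [] ∷ []

Diameter≤2⇒rvc≡srvc≡1 : {D : Digraph (suc n)} → IsTournament D → Diameter≤2 D → RvcSrvcTournament D 1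
Diameter≤2⇒rvc≡srvc≡1 tournament diameter =
  rvc≡srvc≡ tournament (const zero) (Diameter≤2⇒srvc tournament diameter (const zero)) noColours
  where
  noColours : ∀ m → m < 1 → ¬ RVCWith _ m
  noColours zero    _         (c , _) with () ← c zero
  noColours (suc _) (s≤s ()) _

isTournament? : {D : Digraph n} → Decidable D → Dec (IsTournament D)
isTournament? D? =
  all? (λ x → ¬? (D? x x)) ×-dec
  all? (λ x → all? λ y → ¬? (x ≟ y) →-dec (D? x y ⊎-dec D? y x)) ×-dec
  all? (λ x → all? λ y → D? x y →-dec ¬? (D? y x))

Diameter≤2? : {D : Digraph n} → Decidable D → Dec (Diameter≤2 D)
Diameter≤2? D? =
  all? λ u → all? λ v → ¬? (u ≟ v) →-dec (D? u v ⊎-dec any? λ w → D? u w ×-dec D? w v)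

adjoin₂ : Digraph n → Digraph (suc (suc n))
adjoin₂ D zero          (suc zero)    = ⊤
adjoin₂ D (suc zero)    (suc (suc _)) = ⊤
adjoin₂ D (suc (suc _)) zero          = ⊤
adjoin₂ D (suc (suc x)) (suc (suc y)) = D x y
adjoin₂ D _             _             = ⊥

adjoin₂-isTournament : IsTournament D → IsTournament (adjoin₂ D)
adjoin₂-isTournament {D = D} (loopless , total , asym) = loopless′ , total′ , asym′
  where
  loopless′ : ∀ x → ¬ adjoin₂ D x x
  loopless′ (suc (suc x)) = loopless x
  total′ : ∀ x y → x ≢ y → adjoin₂ D x y ⊎ adjoin₂ D y x
  total′ zero          zero          x≢y = ⊥-elim (x≢y refl)
  total′ zero          (suc zero)    _   = inj₁ tt
  total′ zero          (suc (suc _)) _   = inj₂ tt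
  total′ (suc zero)    zero          _   = inj₂ tt
  total′ (suc zero)    (suc zero)    x≢y = ⊥-elim (x≢y refl)
  total′ (suc zero)    (suc (suc _)) _   = inj₁ tt
  total′ (suc (suc _)) zero          _   = inj₁ tt
  total′ (suc (suc _)) (suc zero)    _   = inj₂ tt
  total′ (suc (suc x)) (suc (suc y)) x≢y = total x y (x≢y ∘ cong (λ z → suc (suc z)))
  asym′ : ∀ x y → adjoin₂ D x y → ¬ adjoin₂ D y x
  asym′ zero          (suc zero)    _ ()
  asym′ (suc zero)    (suc (suc _)) _ ()
  asym′ (suc (suc _)) zero          _ ()
  asym′ (suc (suc x)) (suc (suc y)) = asym x y

adjoin₂-Diameter≤2 : {D : Digraph (suc n)} → Diameter≤2 D → Diameter≤2 (adjoin₂ D)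
adjoin₂-Diameter≤2 {D = D} diameter = diameter′
  where
  diameter′ : Diameter≤2 (adjoin₂ D)
  diameter′ zero          zero          x≢y = ⊥-elim (x≢y refl)
  diameter′ zero          (suc zero)    _   = inj₁ tt
  diameter′ zero          (suc (suc _)) _   = inj₂ (suc zero , tt , tt)
  diameter′ (suc zero)    zero          _   = inj₂ (suc (suc zero) , tt , tt)
  diameter′ (suc zero)    (suc zero)    x≢y = ⊥-elim (x≢y refl)
  diameter′ (suc zero)    (suc (suc _)) _   = inj₁ tt
  diameter′ (suc (suc _)) zero          _   = inj₁ tt
  diameter′ (suc (suc _)) (suc zero)    _   = inj₂ (zero , tt , tt)
  diameter′ (suc (suc x)) (suc (suc y)) x≢y with diameter x y (x≢y ∘ cong (λ z → suc (suc z)))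
  ... | inj₁ xy           = inj₁ xy
  ... | inj₂ (w , xw , wy) = inj₂ (suc (suc w) , xw , wy)

rotational₅ : ℕ → ℕ → Bool
rotational₅ x y = let d = (5 + y ∸ x) % 5 in (d ≡ᵇ 1) ∨ (d ≡ᵇ 2)

extended₆ : ℕ → ℕ → Bool
extended₆ x y = ((x <ᵇ 5) ∧ (y <ᵇ 5) ∧ rotational₅ x y)
              ∨ ((x ≡ᵇ 5) ∧ ((y ≡ᵇ 0) ∨ (y ≡ᵇ 2)))
              ∨ ((y ≡ᵇ 5) ∧ ((x ≡ᵇ 1) ∨ (x ≡ᵇ 3) ∨ (x ≡ᵇ 4)))

byTable : (ℕ → ℕ → Bool) → Digraph n
byTable arc x y = T (arc (toℕ x) (toℕ y))

byTable? : (arc : ℕ → ℕ → Bool) → Decidable (byTable {n} arc)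
byTable? arc x y = T? (arc (toℕ x) (toℕ y))

Diameter≤2Tournament : ℕ → Set₁
Diameter≤2Tournament n = Σ (Digraph n) λ D → IsTournament D × Diameter≤2 D

diameter≤2Tournament : ∀ m → Diameter≤2Tournament (5 + m)
diameter≤2Tournament 0 = byTable rotational₅ ,
  toWitness {a? = isTournament? (byTable? rotational₅) ×-dec Diameter≤2? (byTable? rotational₅)} tt
diameter≤2Tournament 1 = byTable extended₆ ,
  toWitness {a? = isTournament? (byTable? extended₆) ×-dec Diameter≤2? (byTable? extended₆)} tt
diameter≤2Tournament (suc (suc m)) with D , tournament , diameter ← diameter≤2Tournament m =
  adjoin₂ D , adjoin₂-isTournament tournament , adjoin₂-Diameter≤2 diameter

-- LayerArc a b x y: an arc from the vertex of level a and index x to that of level b and index y.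
data LayerArc : ℕ → ℕ → ℕ → ℕ → Set where
  up   : ∀ {a x y} → LayerArc a (suc a) x y
  down : ∀ {a b x y} → 2 + b ≤ a → LayerArc a b x y
  flat : ∀ {x y} → x < y → LayerArc 0 0 x y

up-≡ : ∀ {a b x y} → b ≡ suc a → LayerArc a b x y
up-≡ refl = up

flat-≡ : ∀ {a b x y} → a ≡ 0 → b ≡ 0 → x < y → LayerArc a b x y
flat-≡ refl refl = flat

LayerArc-asym : ∀ {a b x y} → LayerArc a b x y → ¬ LayerArc b a y x
LayerArc-asym up           (down 2+a≤1+a) = 1+n≰n (≤-pred 2+a≤1+a)
LayerArc-asym (down 2+b≤1+b) up           = 1+n≰n (≤-pred 2+b≤1+b)
LayerArc-asym (down 2+b≤a) (down 2+a≤b)   = <-asym (≤-trans (n≤1+n _) 2+b≤a) (≤-trans (n≤1+n _) 2+a≤b)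
LayerArc-asym (down ())    (flat _)
LayerArc-asym (flat _)     (down ())
LayerArc-asym (flat x<y)   (flat y<x)     = <-asym x<y y<x

LayerArc-step : ∀ {a b x y} → LayerArc a b x y → b ≤ suc a
LayerArc-step up           = ≤-refl
LayerArc-step (down 2+b≤a) = ≤-trans (m≤n+m _ 2) (≤-trans 2+b≤a (n≤1+n _))
LayerArc-step (flat _)     = z≤n

LayerArc-total : ∀ a b x y → (a ≡ b → a ≡ 0 × x ≢ y) → LayerArc a b x y ⊎ LayerArc b a y x
LayerArc-total a b x y sameLevel with <-cmp a b
... | tri< a<b _ _ with m≤n⇒m<n∨m≡n a<b
...   | inj₁ 2+a≤b = inj₂ (down 2+a≤b)
...   | inj₂ refl  = inj₁ up
LayerArc-total a b x y sameLevel | tri> _ _ b<a with m≤n⇒m<n∨m≡n b<a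
...   | inj₁ 2+b≤a = inj₁ (down 2+b≤a)
...   | inj₂ refl  = inj₂ up
LayerArc-total a b x y sameLevel | tri≈ _ refl _ with sameLevel refl
...   | refl , x≢y with <-cmp x y
...     | tri< x<y _ _ = inj₁ (flat x<y)
...     | tri≈ _ x≡y _ = ⊥-elim (x≢y x≡y)
...     | tri> _ _ y<x = inj₂ (flat y<x)

LayerArc-return : ∀ {c x w y} → LayerArc 0 c x w → LayerArc c 0 w y → x < y
LayerArc-return up         (down (s≤s ()))
LayerArc-return (down ())  _
LayerArc-return (flat _)   (down ())
LayerArc-return (flat x<w) (flat w<y) = <-trans x<w w<y

-- Level 0 holds the e + 1 vertices 0, …, e; level i ≥ 1 holds the single vertex e + i.
module Layered (e j : ℕ) where

  K : ℕ
  K = 2 + j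

  N : ℕ
  N = 2 + K + e

  level : Fin N → ℕ
  level u = toℕ u ∸ e

  layered : Digraph N
  layered u v = LayerArc (level u) (level v) (toℕ u) (toℕ v)

  -- The vertex on level i ≤ K + 1; reducing mod N merely makes rung total.
  rung : ℕ → Fin N
  rung i = (i + e) mod N

  colour : Fin N → Fin K
  colour u = (level u ∸ 1) mod K

  RainbowGeodesic : Fin N → Fin N → Set
  RainbowGeodesic u v = ∃ λ ws → IsGeodesic layered u v ws × Rainbow colour ws

  level≤ : ∀ u → level u ≤ suc K
  level≤ u = ≤-trans (∸-monoˡ-≤ e (≤-pred (toℕ<n u))) (≤-reflexive (m+n∸n≡m (suc K) e))

  level-rung : ∀ {i} → i ≤ suc K → level (rung i) ≡ i
  level-rung {i} i≤1+K = begin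
    toℕ ((i + e) mod N) ∸ e ≡⟨ cong (_∸ e) (toℕ-fromℕ< _) ⟩
    (i + e) % N ∸ e         ≡⟨ cong (_∸ e) (m<n⇒m%n≡m (+-monoˡ-< e (s≤s i≤1+K))) ⟩
    i + e ∸ e               ≡⟨ m+n∸n≡m i e ⟩
    i                       ∎
    where open ≡-Reasoning

  colour-rung : ∀ {i} → i < K → toℕ (colour (rung (suc i))) ≡ i
  colour-rung {i} i<K = begin
    toℕ ((level (rung (suc i)) ∸ 1) mod K) ≡⟨ toℕ-fromℕ< _ ⟩
    (level (rung (suc i)) ∸ 1) % K         ≡⟨ cong (λ l → (l ∸ 1) % K) (level-rung (≤-trans i<K (n≤1+n K))) ⟩
    i % K                                  ≡⟨ m<n⇒m%n≡m i<K ⟩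
    i                                      ∎
    where open ≡-Reasoning

  levels-≢ : ∀ {u v a b} → level u ≡ a → level v ≡ b → a ≢ b → u ≢ v
  levels-≢ refl refl a≢b refl = a≢b refl

  level-injective : ∀ {u v} → level u ≡ level v → level u ≢ 0 → u ≡ v
  level-injective {u} {v} same positive = toℕ-injective (begin
    toℕ u         ≡⟨ m+[n∸m]≡n (<⇒≤ (m∸n≢0⇒n<m {n = e} positive)) ⟨
    e + level u   ≡⟨ cong (e +_) same ⟩
    e + level v   ≡⟨ m+[n∸m]≡n (<⇒≤ (m∸n≢0⇒n<m {n = e} (positive ∘ trans same))) ⟩
    toℕ v         ∎)
    where open ≡-Reasoning

  sameLevel⇒bottom : ∀ {u v} → u ≢ v → level u ≡ level v → level u ≡ 0 × level v ≡ 0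
  sameLevel⇒bottom u≢v same = u₀ , trans (sym same) u₀
    where
    u₀ = decidable-stable (level _ ≟ℕ 0) (u≢v ∘ level-injective same)

  layered-isTournament : IsTournament layered
  layered-isTournament = (λ u uu → LayerArc-asym uu uu) , total , λ _ _ → LayerArc-asym
    where
    total : ∀ u v → u ≢ v → layered u v ⊎ layered v u
    total u v u≢v = LayerArc-total _ _ _ _ λ same → proj₁ (sameLevel⇒bottom u≢v same) , u≢v ∘ toℕ-injective

  ascent : ℕ → ℕ → List (Fin N)
  ascent i zero    = []
  ascent i (suc t) = rung (suc i) ∷ ascent (suc i) t

  length-ascent : ∀ i t → length (ascent i t) ≡ t
  length-ascent i zero    = refl
  length-ascent i (suc t) = cong suc (length-ascent (suc i) t)

  OneUp : Fin N → Fin N → Set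
  OneUp u v = level v ≡ suc (level u)

  ascent-climbs : ∀ {u v} i t → level u ≡ i → level v ≡ suc (t + i) → Linked OneUp (u ∷ ascent i t ++ v ∷ [])
  ascent-climbs {u} {v} i zero    refl v-top = v-top ∷ [-]
  ascent-climbs {u} {v} i (suc t) refl v-top =
    level-rung next≤ ∷ ascent-climbs (suc i) t (level-rung next≤) (trans v-top (cong suc (sym (+-suc t i))))
    where
    next≤ : suc i ≤ suc K
    next≤ = ≤-trans (s≤s (≤-trans (m≤n+m i t) (n≤1+n _))) (subst (_≤ suc K) v-top (level≤ v))

  ascent-Rainbow : ∀ i t → t + i ≤ K → Rainbow colour (ascent i t)
  ascent-Rainbow i t t+i≤K = increasing⇒Unique toℕ (map⁺ (increasing i t t+i≤K))
    where
    increasing : ∀ i t → t + i ≤ K → Linked (_<_ on (toℕ ∘ colour)) (ascent i t)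
    increasing i zero          _     = []
    increasing i (suc zero)    _     = [-]
    increasing i (suc (suc t)) bound =
      subst₂ _<_ (sym (colour-rung (≤-trans (n≤1+n _) 2+i≤K))) (sym (colour-rung 2+i≤K)) ≤-refl ∷
      increasing (suc i) (suc t) (subst (_≤ K) (cong suc (sym (+-suc t i))) bound)
      where
      2+i≤K : 2 + i ≤ K
      2+i≤K = ≤-trans (s≤s (s≤s (m≤n+m i t))) bound

  ascending-geodesic : ∀ {u v} → level u < level v → RainbowGeodesic u v
  ascending-geodesic {u} {v} u<v =
    ascent i t ,
    ((increasing⇒Unique level (Linked.map (≤-reflexive ∘ sym) climbs) , Linked.map up-≡ climbs) , shortest) ,
    ascent-Rainbow i t (≤-pred (subst (_≤ suc K) v-top (level≤ v)))
    where
    i = level u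
    t = level v ∸ suc i
    v-top : level v ≡ suc (t + i)
    v-top = trans (sym (m∸n+n≡m u<v)) (+-suc t i)
    climbs : Linked OneUp (u ∷ ascent i t ++ v ∷ [])
    climbs = ascent-climbs i t refl v-top
    shortest : ∀ ws → IsPath layered u v ws → length (ascent i t) ≤ length ws
    shortest ws (_ , arcs) = subst (_≤ length ws) (sym (length-ascent i t))
      (+-cancelʳ-≤ i t (length ws) (≤-pred (subst (_≤ suc (length ws + i)) v-top (height-bound level LayerArc-step ws arcs))))

  -- Going back within level 0 needs the detour through levels 1 and 2.
  bottom-geodesic : ∀ {u v} → u ≢ v → level u ≡ 0 → level v ≡ 0 → toℕ v < toℕ u → RainbowGeodesic u v
  bottom-geodesic {u} {v} u≢v u₀ v₀ v<u =
    ascent 0 2 , ((distinct , arcs) , shortest) , ascent-Rainbow 0 2 (s≤s (s≤s z≤n))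
    where
    r₁ r₂ : Fin N
    r₁ = rung 1
    r₂ = rung 2
    r₁-level : level r₁ ≡ 1
    r₁-level = level-rung (s≤s z≤n)
    r₂-level : level r₂ ≡ 2
    r₂-level = level-rung (s≤s (s≤s z≤n))
    distinct : Unique (u ∷ r₁ ∷ r₂ ∷ v ∷ [])
    distinct = (levels-≢ u₀ r₁-level (λ ()) ∷ levels-≢ u₀ r₂-level (λ ()) ∷ u≢v ∷ [])
             ∷ (levels-≢ r₁-level r₂-level (λ ()) ∷ levels-≢ r₁-level v₀ (λ ()) ∷ [])
             ∷ (levels-≢ r₂-level v₀ (λ ()) ∷ [])
             ∷ [] ∷ []
    arcs : Linked layered (u ∷ r₁ ∷ r₂ ∷ v ∷ [])
    arcs = up-≡ (trans r₁-level (cong suc (sym u₀)))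
         ∷ up-≡ (trans r₂-level (cong suc (sym r₁-level)))
         ∷ down (subst₂ _≤_ (cong (2 +_) (sym v₀)) (sym r₂-level) ≤-refl)
         ∷ [-]
    shortest : ∀ ws → IsPath layered u v ws → 2 ≤ length ws
    shortest []          (_ , uv ∷ _)      = ⊥-elim (LayerArc-asym (flat-≡ v₀ u₀ v<u) uv)
    shortest (w ∷ [])    (_ , uw ∷ wv ∷ _) = ⊥-elim (<-asym v<u (LayerArc-return
      (subst (λ a → LayerArc a (level w) (toℕ u) (toℕ w)) u₀ uw)
      (subst (λ b → LayerArc (level w) b (toℕ w) (toℕ v)) v₀ wv)))
    shortest (_ ∷ _ ∷ _) _                 = s≤s (s≤s z≤n)

  sameLevel-geodesic : ∀ {u v} → u ≢ v → level u ≡ level v → RainbowGeodesic u v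
  sameLevel-geodesic {u} {v} u≢v same with u₀ , v₀ ← sameLevel⇒bottom u≢v same | <-cmp (toℕ u) (toℕ v)
  ... | tri< u<v _ _ = [] , arc⇒IsGeodesic u≢v (flat-≡ u₀ v₀ u<v) , []
  ... | tri≈ _ u≡v _ = ⊥-elim (u≢v (toℕ-injective u≡v))
  ... | tri> _ _ v<u = bottom-geodesic u≢v u₀ v₀ v<u

  -- When v is just below u, return by climbing one level past u and falling two,
  -- or, from the top level K + 1, by falling two levels and climbing one.
  descending-geodesic : ∀ {u v} → u ≢ v → level v < level u → RainbowGeodesic u v
  descending-geodesic {u} {v} u≢v v<u with m≤n⇒m<n∨m≡n v<u
  ... | inj₁ 2+v≤u = [] , arc⇒IsGeodesic u≢v (down 2+v≤u) , []
  ... | inj₂ u-next with m≤n⇒m<n∨m≡n (level≤ u)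
  ...   | inj₁ u<top = w ∷ [] , detour⇒IsGeodesic layered-isTournament u≢v
          (up-≡ w-level) (down (≤-reflexive (trans (cong suc u-next) (sym w-level)))) (up-≡ (sym u-next)) , [] ∷ []
    where
    w = rung (suc (level u))
    w-level : level w ≡ suc (level u)
    w-level = level-rung u<top
  ...   | inj₂ u-top = w ∷ [] , detour⇒IsGeodesic layered-isTournament u≢v
          (down (≤-reflexive (trans (cong (2 +_) w-level) (sym u-top))))
          (up-≡ (trans (suc-injective (trans u-next u-top)) (cong suc (sym w-level)))) (up-≡ (sym u-next)) , [] ∷ []
    where
    w = rung (suc j)
    w-level : level w ≡ suc j
    w-level = level-rung (≤-trans (n≤1+n _) (n≤1+n _))

  layered-srvc : StronglyRainbowVertexConnected layered colour
  layered-srvc u v u≢v with <-cmp (level u) (level v)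
  ... | tri< u<v _ _ = ascending-geodesic u<v
  ... | tri≈ _ same _ = sameLevel-geodesic u≢v same
  ... | tri> _ _ v<u = descending-geodesic u≢v v<u

  bottom top : Fin N
  bottom = rung 0
  top    = rung (suc K)

  bottom-top-path-length : ∀ ws → IsPath layered bottom top ws → K ≤ length ws
  bottom-top-path-length ws (_ , arcs) = ≤-pred (subst₂ _≤_ (level-rung ≤-refl)
    (cong suc (trans (cong (length ws +_) (level-rung z≤n)) (+-identityʳ _)))
    (height-bound level LayerArc-step ws arcs))

  layered-rvc≡srvc≡ : RvcSrvcTournament layered K
  layered-rvc≡srvc≡ = rvc≡srvc≡ layered-isTournament colour layered-srvc
    (pathLength⇒¬RVCWith (levels-≢ (level-rung z≤n) (level-rung ≤-refl) (λ ())) bottom-top-path-length)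

theorem18 : ∀ (n k : ℕ) → 5 ≤ n → 1 ≤ k → k ≤ n ∸ 2 →
    Σ (Digraph n) λ T →
      IsTournament T × StronglyConnected T × rvc≡ T k × srvc≡ T k
theorem18 n zero          _   ()  _
theorem18 n (suc zero)    5≤n _   _ with D , tournament , diameter ← diameter≤2Tournament (n ∸ 5) =
  subst (λ m → Σ (Digraph m) λ T → RvcSrvcTournament T 1) (m+[n∸m]≡n 5≤n)
    (D , Diameter≤2⇒rvc≡srvc≡1 tournament diameter)
theorem18 n (suc (suc j)) 5≤n _   k≤n-2 =
  subst (λ m → Σ (Digraph m) λ T → RvcSrvcTournament T (2 + j)) (m+[n∸m]≡n 4+j≤n)
    (layered , layered-rvc≡srvc≡)
  where
  open Layered (n ∸ (4 + j)) j
  4+j≤n : 4 + j ≤ n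
  4+j≤n = subst (_≤ n) (+-comm (2 + j) 2) (m≤o∸n⇒m+n≤o (2 + j) (≤-trans (s≤s (s≤s z≤n)) 5≤n) k≤n-2)
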